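{- Let $\Phi$ be a pure Horn CNF over variable set $V$, and let $D_\Phi$ be a directed graph on vertex set $\mathcal{K}(\Phi)$ constructed as follows: for every minimal key $K\in\mathcal{K}(\Phi)$, every variable $v\in K$ and every clause $A\to v$ of $\Phi$, let $S=(K\setminus\{v\})\cup A$ (which is a key of $\Phi$), choose (arbitrarily) a minimal key $K'\in\mathcal{K}(\Phi)$ with $K'\subseteq S$, and add the directed edge $KK'$. Then $D_\Phi$ is strongly connected, regardless of the choices made.
   Context: A pure Horn CNF over $V$ is a conjunction of clauses $A\to v$ with $A\subseteq V$, $v\in V$ (meaning $v\vee\bigvee_{a\in A}\bar a$). A set $K\subseteq V$ is a key of $\Phi$ if $K\to u$ is implied by $\Phi$ for every $u\in V\setminus K$ (equivalently, forward chaining from $K$ — repeatedly adding $v$ whenever a clause $A\to v$ of $\Phi$ has $A$ contained in the current set — yields $V$). $\mathcal{K}(\Phi)$ is the family of inclusion-wise minimal keys of $\Phi$. -}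

module Defs where

open import Data.Nat using (ℕ)
open import Data.Fin using (Fin)
open import Data.Fin.Subset using (Subset; _∈_; _⊆_; _∪_; _-_)
open import Data.List using (List)
import Data.List.Membership.Propositional as LM
open import Data.Product using (_×_; _,_; Σ; ∃; ∃-syntax)
open import Relation.Binary.PropositionalEquality using (_≡_)
open import Relation.Binary.Construct.Closure.ReflexiveTransitive using (Star)

-- A clause A → v over variable set V = Fin n.
Clause : ℕ → Set
Clause n = Subset n × Fin n

HornCNF : ℕ → Set
HornCNF n = List (Clause n)

data Closure {n : ℕ} (Φ : HornCNF n) (K : Subset n) : Fin n → Set where
  base : ∀ {u} → u ∈ K → Closure Φ K u
  step : ∀ {A v} → (A , v) LM.∈ Φ → (∀ {a} → a ∈ A → Closure Φ K a) → Closure Φ K v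

IsKey : {n : ℕ} → HornCNF n → Subset n → Set
IsKey Φ K = ∀ u → Closure Φ K u

IsMinKey : {n : ℕ} → HornCNF n → Subset n → Set
IsMinKey Φ K = IsKey Φ K × (∀ K' → K' ⊆ K → IsKey Φ K' → K' ≡ K)

record Choice {n : ℕ} (Φ : HornCNF n) : Set where
  field
    choose   : Subset n → Fin n → Subset n → Subset n
    chooseOK : ∀ K v A → IsMinKey Φ K → v ∈ K → (A , v) LM.∈ Φ →
               IsMinKey Φ (choose K v A) × choose K v A ⊆ ((K - v) ∪ A)

Edge : {n : ℕ} {Φ : HornCNF n} → Choice Φ → Subset n → Subset n → Set
Edge {n} {Φ} c K K' = ∃[ v ] ∃[ A ]
  (IsMinKey Φ K × v ∈ K × (A , v) LM.∈ Φ × Choice.choose c K v A ≡ K')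

Reach : {n : ℕ} {Φ : HornCNF n} → Choice Φ → Subset n → Subset n → Set
Reach c = Star (Edge c)

StronglyConnected : {n : ℕ} {Φ : HornCNF n} → Choice Φ → Set
StronglyConnected {n} {Φ} c = ∀ K K' → IsMinKey Φ K → IsMinKey Φ K' → Reach c K K'

module Submission where

-- Fix a target minimal key T.  Stratify forward chaining from T into levels:
-- level 0 is T itself and x is at level j+1 if it is at level j or some
-- clause A → x has all of A at level j.  Since T is a key, every variable has
-- a level, and as V is finite every set K lies entirely inside one level j.
-- We show by induction on j that every minimal key K inside level j reaches T.
-- For j = 0, K ⊆ T forces K = T by minimality of T.  For j+1 we sweep over
-- the variables b of V once: if b ∈ K is at level j+1 but not at level j,
-- some clause A → b has A at level j, and the edge of D_Φ for (K, b, A)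
-- leads to a minimal key inside (K ∖ {b}) ∪ A, which no longer contains b
-- and adds only variables of level j.  After the sweep the current key lies
-- inside level j, and the induction hypothesis finishes the path.

open import Defs
open import Data.Nat using (ℕ; zero; suc; _≤_; _≤′_; ≤′-step; _⊔_)
open import Data.Nat.Properties using (m≤m⊔n; m≤n⊔m; ≤⇒≤′)
open import Data.Bool using (true; false)
open import Data.Fin using (Fin; zero; suc)
open import Data.Fin.Subset using (Subset; _∈_; _∉_; _─_; _-_; ⁅_⁆)
open import Data.Fin.Subset.Properties using (_∈?_; x∈p∪q⁻; x∈⁅x⁆)
open import Data.Vec using (_∷_; here; there)
open import Data.List using (List; []; _∷_; allFin)
import Data.List.Membership.Propositional as List
open import Data.List.Membership.Propositional.Properties using (∈-allFin)
import Data.List.Relation.Unary.Any as ListAny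
open import Data.Product using (_×_; _,_; Σ; ∃; proj₁; proj₂)
open import Data.Sum using (_⊎_; inj₁; inj₂)
open import Data.Empty using (⊥-elim)
open import Relation.Nullary using (yes; no)
open import Relation.Binary.PropositionalEquality using (_≡_; _≢_; refl; subst)
open import Relation.Binary.Construct.Closure.ReflexiveTransitive using (ε; _◅_)

x∈p─q⁻ : ∀ {n} (p q : Subset n) {x} → x ∈ p ─ q → x ∈ p × x ∉ q
x∈p─q⁻ (true  ∷ p) (false ∷ q) here = here , λ ()
x∈p─q⁻ (true  ∷ p) (true  ∷ q) {zero} ()
x∈p─q⁻ (false ∷ p) (true  ∷ q) {zero} ()
x∈p─q⁻ (false ∷ p) (false ∷ q) {zero} ()
x∈p─q⁻ (s ∷ p) (t ∷ q) (there x∈p─q) =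
  let (x∈p , x∉q) = x∈p─q⁻ p q x∈p─q
  in there x∈p , λ { (there x∈q) → x∉q x∈q }

x∈p-y⁻ : ∀ {n} (p : Subset n) (y : Fin n) {x} → x ∈ p - y → x ∈ p × x ≢ y
x∈p-y⁻ p y x∈p-y with x∈p─q⁻ p ⁅ y ⁆ x∈p-y
... | x∈p , x∉⁅y⁆ = x∈p , λ { refl → x∉⁅y⁆ (x∈⁅x⁆ y) }

uniformBound : ∀ {n} (P : Fin n → ℕ → Set) →
               (∀ i {j k} → j ≤ k → P i j → P i k) →
               (∀ i → ∃ (P i)) → ∃ λ j → ∀ i → P i j
uniformBound {zero}  P mono witness = 0 , λ ()
uniformBound {suc n} P mono witness
  with witness zero | uniformBound (λ i → P (suc i)) (λ i → mono (suc i)) (λ i → witness (suc i))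
... | j₀ , p₀ | j₁ , p₁ = j₀ ⊔ j₁ , λ { zero    → mono zero    (m≤m⊔n j₀ j₁) p₀
                                      ; (suc i) → mono (suc i) (m≤n⊔m j₀ j₁) (p₁ i) }

choose-⊆ : ∀ {n} {Φ : HornCNF n} (c : Choice Φ) {K v A} →
           IsMinKey Φ K → v ∈ K → (A , v) List.∈ Φ →
           ∀ {x} → x ∈ Choice.choose c K v A → (x ∈ K × x ≢ v) ⊎ x ∈ A
choose-⊆ c {K} {v} {A} isMinK v∈K clause x∈K'
  with x∈p∪q⁻ (K - v) A (proj₂ (Choice.chooseOK c K v A isMinK v∈K clause) x∈K')
... | inj₁ x∈K-v = inj₁ (x∈p-y⁻ K v x∈K-v)
... | inj₂ x∈A   = inj₂ x∈A

module Levels {n : ℕ} (Φ : HornCNF n) (T : Subset n) where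

  mutual
    Level : ℕ → Fin n → Set
    Level zero    x = x ∈ T
    Level (suc j) x = Level j x ⊎ Derived j x

    Derived : ℕ → Fin n → Set
    Derived j x = Σ (Subset n) λ A → (A , x) List.∈ Φ × Within A j

    Within : Subset n → ℕ → Set
    Within A j = ∀ {a} → a ∈ A → Level j a

  Level-mono′ : ∀ {j k x} → j ≤′ k → Level j x → Level k x
  Level-mono′ (Data.Nat.≤′-reflexive refl) l = l
  Level-mono′ (≤′-step j≤′k)               l = inj₁ (Level-mono′ j≤′k l)

  Level-mono : ∀ {j k x} → j ≤ k → Level j x → Level k x
  Level-mono j≤k = Level-mono′ (≤⇒≤′ j≤k)

  bounded : (A : Subset n) → (∀ {a} → a ∈ A → ∃ λ j → Level j a) →
            ∃ λ j → Within A j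
  bounded A leveled with uniformBound (λ a j → a ∈ A → Level j a)
                                      (λ a j≤k l a∈A → Level-mono j≤k (l a∈A))
                                      witness
    where
    witness : ∀ a → ∃ λ j → a ∈ A → Level j a
    witness a with a ∈? A
    ... | yes a∈A = let (j , l) = leveled a∈A in j , λ _ → l
    ... | no  a∉A = 0 , λ a∈A → ⊥-elim (a∉A a∈A)
  ... | j , A⊆Level = j , λ {a} → A⊆Level a

  closure⇒level : ∀ {x} → Closure Φ T x → ∃ λ j → Level j x
  closure⇒level (base x∈T) = 0 , x∈T
  closure⇒level (step clause body)
    with bounded _ (λ a∈A → closure⇒level (body a∈A))
  ... | j , A⊆Level = suc j , inj₂ (_ , clause , A⊆Level)

module ReachTarget {n : ℕ} {Φ : HornCNF n} (c : Choice Φ)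
                   (T : Subset n) (isMinT : IsMinKey Φ T) where
  open Levels Φ T
  open Choice c

  -- Sweep invariant at stage j with pending variables B: x is at level j,
  -- or it is still to be processed and at level j+1.
  Pending : ℕ → List (Fin n) → Fin n → Set
  Pending j B x = Level j x ⊎ (x List.∈ B × Level (suc j) x)

  discharge : ∀ {j b B x} → (x ≡ b → Level j x) → Pending j (b ∷ B) x → Pending j B x
  discharge b-done (inj₁ l)                      = inj₁ l
  discharge b-done (inj₂ (ListAny.here refl , _)) = inj₁ (b-done refl)
  discharge b-done (inj₂ (ListAny.there x∈B , l)) = inj₂ (x∈B , l)

  sweep : ∀ j → (∀ K → IsMinKey Φ K → Within K j → Reach c K T) →
          ∀ B K → IsMinKey Φ K → (∀ {x} → x ∈ K → Pending j B x) → Reach c K T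
  sweep j ih [] K isMinK pending = ih K isMinK λ x∈K → settled (pending x∈K)
    where
    settled : ∀ {x} → Pending j [] x → Level j x
    settled (inj₁ l) = l
  sweep j ih (b ∷ B) K isMinK pending with b ∈? K
  ... | no b∉K = sweep j ih B K isMinK λ x∈K →
                   discharge (λ { refl → ⊥-elim (b∉K x∈K) }) (pending x∈K)
  ... | yes b∈K with pending b∈K
  ...   | inj₁ lb            = sweep j ih B K isMinK λ x∈K → discharge (λ { refl → lb }) (pending x∈K)
  ...   | inj₂ (_ , inj₁ lb) = sweep j ih B K isMinK λ x∈K → discharge (λ { refl → lb }) (pending x∈K)
  -- b derived from a clause A → b with A at level j: follow the edge (K, b, A)
  ...   | inj₂ (_ , inj₂ (A , clause , A⊆Level)) =
          (b , A , isMinK , b∈K , clause , refl)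
            ◅ sweep j ih B (choose K b A) (proj₁ (chooseOK K b A isMinK b∈K clause)) pending′
    where
    -- the new key keeps the invariant: b has left and A is at level j
    pending′ : ∀ {x} → x ∈ choose K b A → Pending j B x
    pending′ x∈K′ with choose-⊆ c isMinK b∈K clause x∈K′
    ... | inj₁ (x∈K , x≢b) = discharge (λ x≡b → ⊥-elim (x≢b x≡b)) (pending x∈K)
    ... | inj₂ x∈A         = inj₁ (A⊆Level x∈A)

  fromLevel : ∀ j K → IsMinKey Φ K → Within K j → Reach c K T
  fromLevel zero    K isMinK K⊆T = subst (Reach c K) (proj₂ isMinT K K⊆T (proj₁ isMinK)) ε
  fromLevel (suc j) K isMinK K⊆Level =
    sweep j (fromLevel j) (allFin n) K isMinK λ {x} x∈K → inj₂ (∈-allFin x , K⊆Level x∈K)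

  -- K lies inside some level because T is a key and V is finite.
  reach : ∀ K → IsMinKey Φ K → Reach c K T
  reach K isMinK =
    let (j , K⊆Level) = bounded K (λ {a} _ → closure⇒level (proj₁ isMinT a))
    in fromLevel j K isMinK K⊆Level

lemma5 : (n : ℕ) (Φ : HornCNF n) (c : Choice Φ) → StronglyConnected c
lemma5 n Φ c K T isMinK isMinT = ReachTarget.reach c T isMinT K isMinK
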